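{- Let $u$ be a recurrent aperiodic infinite word over a finite ordered alphabet, and let $w$ and $v$ be factors of $u$. Then it is impossible that there exist $k,l\ge 0$ such that $T^k(u)$ is the lexicographically maximal element of the shift orbit closure of $u$ among those starting with $w$, and simultaneously $T^l(u)$ is the lexicographically minimal element of the shift orbit closure of $u$ among those starting with $v$. (That is, the orbit $\{T^n(u)\}_{n\ge0}$ may contain the maximal element starting with $w$, or the minimal element starting with $v$, but not both.)
   Context: $T^n u=u[n]u[n+1]\cdots$ denotes the $n$th shift of the infinite word $u$. Words are compared in lexicographic order induced by the order $0<1<\dots<q-1$ on the alphabet. The shift orbit closure of $u$ is the closure of $\{T^n u: n\ge 0\}$ in the product topology. A word is recurrent if every factor occurs infinitely often, and aperiodic if it is not ultimately periodic. -}

module Defs where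

open import Data.Nat using (ℕ; _+_; _≤_; _<_)
open import Data.Fin as Fin using (Fin; toℕ)
open import Data.List using (List; length; lookup)
open import Data.Product using (Σ; ∃; ∃-syntax; _×_)
open import Data.Sum using (_⊎_)
open import Relation.Nullary using (¬_)
open import Relation.Binary.PropositionalEquality using (_≡_)

Word : ℕ → Set
Word q = ℕ → Fin q

FinWord : ℕ → Set
FinWord q = List (Fin q)

T : ∀ {q} → ℕ → Word q → Word q
T n u i = u (n + i)

StartsWith : ∀ {q} → Word q → FinWord q → Set
StartsWith x w = (i : Fin (length w)) → x (toℕ i) ≡ lookup w i

Factor : ∀ {q} → Word q → FinWord q → Set
Factor u w = ∃[ m ] StartsWith (T m u) w

Recurrent : ∀ {q} → Word q → Set
Recurrent u = ∀ w → Factor u w → ∀ N → ∃[ m ] (N ≤ m × StartsWith (T m u) w)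

UltimatelyPeriodic : ∀ {q} → Word q → Set
UltimatelyPeriodic u = ∃[ p ] ∃[ N ] (0 < p × (∀ n → N ≤ n → u (n + p) ≡ u n))

Aperiodic : ∀ {q} → Word q → Set
Aperiodic u = ¬ UltimatelyPeriodic u

-- Membership in the shift orbit closure of u (product topology):
-- every neighbourhood (cylinder of a prefix of length n) of x meets the orbit.
InOrbitClosure : ∀ {q} → Word q → Word q → Set
InOrbitClosure u x = ∀ n → ∃[ m ] (∀ i → i < n → x i ≡ T m u i)

_<lex_ : ∀ {q} → Word q → Word q → Set
x <lex y = ∃[ n ] ((∀ i → i < n → x i ≡ y i) × x n Fin.< y n)

_≈w_ : ∀ {q} → Word q → Word q → Set
x ≈w y = ∀ i → x i ≡ y i

_≤lex_ : ∀ {q} → Word q → Word q → Set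
x ≤lex y = x <lex y ⊎ x ≈w y

IsMaxStartingWith : ∀ {q} → Word q → FinWord q → Word q → Set
IsMaxStartingWith u w y =
  InOrbitClosure u y × StartsWith y w ×
  (∀ x → InOrbitClosure u x → StartsWith x w → x ≤lex y)

IsMinStartingWith : ∀ {q} → Word q → FinWord q → Word q → Set
IsMinStartingWith u v y =
  InOrbitClosure u y × StartsWith y v ×
  (∀ x → InOrbitClosure u x → StartsWith x v → y ≤lex x)

-- Choose L so long that the prefix u[0, L) covers both windows
-- [k, k + |w|) and [l, l + |v|). By recurrence this prefix occurs again at some
-- position m ≥ 1, and we show T^m u = u letter by letter. Below L this is the
-- occurrence itself. At a position i ≥ L, the word T^{m+k} u lies in the orbit
-- and starts with w, so it is lexicographically at most the maximum T^k u; as the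
-- two agree before position i - k (induction), u[m + i] ≤ u[i]. Minimality of
-- T^l u gives the reverse inequality. Hence u is periodic, contradicting aperiodicity.
module Submission where

open import Defs
open import Data.Nat using (ℕ; zero; suc; _+_; _∸_; _≤_; _<_; _<?_; s≤s)
open import Data.Nat.Properties
  using (+-assoc; +-comm; m+[n∸m]≡n; +-monoʳ-<; <-≤-trans; ≤-trans; m≤m+n; m≤n+m; ≮⇒≥; <-cmp; <⇒≤)
open import Data.Nat.Induction using (<-rec)
open import Data.Fin as Fin using (toℕ)
import Data.Fin.Properties as Fin
open import Data.List using ([]; _∷_; length)
open import Data.Product using (∃-syntax; _×_; _,_)
open import Data.Sum using (inj₁; inj₂)
open import Relation.Nullary using (¬_; yes; no; contradiction)
open import Relation.Binary using (tri<; tri≈; tri>)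
open import Relation.Binary.PropositionalEquality using (_≡_; refl; sym; trans; cong; subst)

private
  variable
    q : ℕ

Agree : ℕ → Word q → Word q → Set
Agree n x y = ∀ i → i < n → x i ≡ y i

prefix : Word q → ℕ → FinWord q
prefix x zero    = []
prefix x (suc n) = x 0 ∷ prefix (T 1 x) n

startsWith-prefix : ∀ n (x : Word q) → StartsWith x (prefix x n)
startsWith-prefix (suc n) x Fin.zero    = refl
startsWith-prefix (suc n) x (Fin.suc i) = startsWith-prefix n (T 1 x) i

startsWith-prefix⇒agree : ∀ n (x y : Word q) → StartsWith x (prefix y n) → Agree n x y
startsWith-prefix⇒agree (suc n) x y sw zero    _         = sw Fin.zero
startsWith-prefix⇒agree (suc n) x y sw (suc i) (s≤s i<n) =
  startsWith-prefix⇒agree n (T 1 x) (T 1 y) (λ j → sw (Fin.suc j)) i i<n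

agree-T : ∀ {s n} {x y : Word q} → Agree (s + n) x y → Agree n (T s x) (T s y)
agree-T {s = s} agree i i<n = agree (s + i) (+-monoʳ-< s i<n)

agree-T-∸ : ∀ {s n} {x y : Word q} → s ≤ n → Agree n x y → Agree (n ∸ s) (T s x) (T s y)
agree-T-∸ {s = s} {x = x} {y} s≤n agree =
  agree-T {s = s} {x = x} {y} (subst (λ n → Agree n x y) (sym (m+[n∸m]≡n s≤n)) agree)

startsWith-resp-agree : ∀ {w} {x y : Word q} → Agree (length w) x y → StartsWith y w → StartsWith x w
startsWith-resp-agree agree sw i = trans (agree (toℕ i) (Fin.toℕ<n i)) (sw i)

recurrent⇒prefix-returns : {u : Word q} → Recurrent u → ∀ L → ∃[ m ] (0 < m × Agree L (T m u) u)
recurrent⇒prefix-returns {u = u} rec L with rec (prefix u L) (0 , startsWith-prefix L u) 1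
... | m , 1≤m , sw = m , 1≤m , startsWith-prefix⇒agree L (T m u) u sw

T-T-inOrbitClosure : ∀ m k (u : Word q) → InOrbitClosure u (T k (T m u))
T-T-inOrbitClosure m k u _ = m + k , λ i _ → sym (cong u (+-assoc m k i))

≤lex-agree⇒≤ : ∀ {n} {x y : Word q} → Agree n x y → x ≤lex y → x n Fin.≤ y n
≤lex-agree⇒≤ {n = n} agree (inj₂ x≈y) = Fin.≤-reflexive (x≈y n)
≤lex-agree⇒≤ {n = n} agree (inj₁ (d , agreeᵈ , xd<yd)) with <-cmp d n
... | tri< d<n _ _ = contradiction xd<yd (Fin.<-irrefl (agree d d<n))
... | tri≈ _ refl _ = <⇒≤ xd<yd
... | tri> _ _ n<d = Fin.≤-reflexive (agreeᵈ n n<d)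

max-bound : ∀ {u : Word q} {w k m i} → IsMaxStartingWith u w (T k u) →
  Agree (k + length w) (T m u) u → k ≤ i → Agree i (T m u) u → u (m + i) Fin.≤ u i
max-bound {u = u} {w} {k} {m} (_ , sw , maximal) agreeʷ k≤i agree =
  subst (λ n → u (m + n) Fin.≤ u n) (m+[n∸m]≡n k≤i)
    (≤lex-agree⇒≤ (agree-T-∸ k≤i agree)
      (maximal _ (T-T-inOrbitClosure m k u)
        (startsWith-resp-agree {w = w} (agree-T {s = k} agreeʷ) sw)))

min-bound : ∀ {u : Word q} {v l m i} → IsMinStartingWith u v (T l u) →
  Agree (l + length v) (T m u) u → l ≤ i → Agree i (T m u) u → u i Fin.≤ u (m + i)
min-bound {u = u} {v} {l} {m} (_ , sw , minimal) agreeᵛ l≤i agree =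
  subst (λ n → u n Fin.≤ u (m + n)) (m+[n∸m]≡n l≤i)
    (≤lex-agree⇒≤ (λ j j<n → sym (agree-T-∸ l≤i agree j j<n))
      (minimal _ (T-T-inOrbitClosure m l u)
        (startsWith-resp-agree {w = v} (agree-T {s = l} agreeᵛ) sw)))

return-of-prefix⇒period : ∀ {u : Word q} {w v k l m L} →
  IsMaxStartingWith u w (T k u) → IsMinStartingWith u v (T l u) →
  k + length w ≤ L → l + length v ≤ L → Agree L (T m u) u → T m u ≈w u
return-of-prefix⇒period {u = u} {w} {v} {k} {l} {m} {L} max min kw≤L lv≤L agreeᴸ =
  <-rec _ (λ i ih → step i (λ j → ih {j}))
  where
  step : ∀ i → Agree i (T m u) u → T m u i ≡ u i
  step i agree with i <? L
  ... | yes i<L = agreeᴸ i i<L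
  ... | no i≮L = Fin.≤-antisym
    (max-bound {w = w} max (within kw≤L) (≤-trans (m≤m+n k _) kw≤i) agree)
    (min-bound {v = v} min (within lv≤L) (≤-trans (m≤m+n l _) lv≤i) agree)
    where
    within : ∀ {n} → n ≤ L → Agree n (T m u) u
    within n≤L j j<n = agreeᴸ j (<-≤-trans j<n n≤L)
    kw≤i : k + length w ≤ i
    kw≤i = ≤-trans kw≤L (≮⇒≥ i≮L)
    lv≤i : l + length v ≤ i
    lv≤i = ≤-trans lv≤L (≮⇒≥ i≮L)

period⇒ultimatelyPeriodic : ∀ {m} {u : Word q} → 0 < m → T m u ≈w u → UltimatelyPeriodic u
period⇒ultimatelyPeriodic {m = m} {u} 0<m period =
  m , 0 , 0<m , λ n _ → trans (cong u (+-comm n m)) (period n)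

proposition2 : (q : ℕ) (u : Word q) → Recurrent u → Aperiodic u →
    (w v : FinWord q) → Factor u w → Factor u v →
    ¬ (∃[ k ] ∃[ l ] (IsMaxStartingWith u w (T k u) × IsMinStartingWith u v (T l u)))
proposition2 q u rec aperiodic w v _ _ (k , l , max , min)
  with recurrent⇒prefix-returns rec ((k + length w) + (l + length v))
... | m , 0<m , agree =
  aperiodic (period⇒ultimatelyPeriodic 0<m
    (return-of-prefix⇒period {w = w} {v} max min (m≤m+n _ _) (m≤n+m _ (k + length w)) agree))
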